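{- Let $n$ and $r$ be integers with $2\le r\le n-2$. Then the Johnson graph $J(n,r)$ is strongly $2$-monophonic.
   Context: The Johnson graph $J(n,r)$ has as vertices all $r$-element subsets of $[n]=\{1,\dots,n\}$, two vertices $A,B$ being adjacent iff $|A\cap B|=r-1$. For a graph $G$ and $u,v\in V(G)$, the monophonic interval $J_G(u,v)$ is the set of all vertices lying on some induced $u,v$-path in $G$, with the convention $u,v\in J_G(u,v)$. A set $S\subseteq V(G)$ is monophonic if for every $w\in V(G)$ there exist $x,y\in S$ with $w\in J_G(x,y)$; $m(G)$ is the minimum size of a monophonic set. $G$ is $2$-monophonic if $m(G)=2$, and strongly $2$-monophonic if it is $2$-monophonic and $\{x,y\}$ is a monophonic set for every pair of non-adjacent vertices $x,y$. -}

module Defs where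

open import Data.Nat using (ℕ; zero; suc; _∸_; _≤_)
open import Data.Fin using (Fin; toℕ)
open import Data.Fin.Subset using (Subset; ∣_∣; _∩_)
open import Data.Product using (Σ; ∃; ∃-syntax; _×_; _,_; proj₁)
open import Data.Sum using (_⊎_)
open import Data.List using (List; []; _∷_; length)
open import Data.List.Membership.Propositional using (_∈_)
open import Data.List.Relation.Unary.Unique.Propositional using (Unique)
open import Function.Bundles using (_⇔_)
open import Function.Definitions using (Injective)
open import Relation.Binary.PropositionalEquality using (_≡_)
open import Relation.Nullary using (¬_)

record Graph : Set₁ where
  field
    V   : Set
    Adj : V → V → Set
open Graph public

JVertex : ℕ → ℕ → Set
JVertex n r = Σ (Subset n) (λ A → ∣ A ∣ ≡ r)

Johnson : ℕ → ℕ → Graph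
Johnson n r = record
  { V   = JVertex n r
  ; Adj = λ A B → ∣ proj₁ A ∩ proj₁ B ∣ ≡ r ∸ 1
  }

module _ (G : Graph) where

  record InducedPath (u v : V G) : Set where
    field
      len      : ℕ
      vert     : Fin (suc len) → V G
      distinct : Injective _≡_ _≡_ vert
      start    : ∃[ i ] (toℕ i ≡ 0 × vert i ≡ u)
      end      : ∃[ i ] (toℕ i ≡ len × vert i ≡ v)
      induced  : ∀ i j → Adj G (vert i) (vert j)
                   ⇔ (toℕ j ≡ suc (toℕ i) ⊎ toℕ i ≡ suc (toℕ j))

  OnInducedPath : V G → V G → V G → Set
  OnInducedPath u v w =
    Σ (InducedPath u v) (λ P → ∃[ i ] (InducedPath.vert P i ≡ w))

  InInterval : V G → V G → V G → Set
  InInterval u v w = w ≡ u ⊎ w ≡ v ⊎ OnInducedPath u v w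

  Monophonic : List (V G) → Set
  Monophonic S = ∀ w → ∃[ x ] ∃[ y ] (x ∈ S × y ∈ S × InInterval x y w)

  -- m(G) = 2: there is a monophonic set of size 2, and every monophonic set
  -- (list without repetitions) has size at least 2.
  TwoMonophonic : Set
  TwoMonophonic =
    (∃[ S ] (Unique S × length S ≡ 2 × Monophonic S))
    × (∀ S → Unique S → Monophonic S → 2 ≤ length S)

  StronglyTwoMonophonic : Set
  StronglyTwoMonophonic =
    TwoMonophonic
    × (∀ x y → ¬ (x ≡ y) → ¬ Adj G x y → Monophonic (x ∷ y ∷ []))

-- In J(n,r) two r-sets are adjacent exactly when they differ in one point, so a
-- sequence of r-sets is an induced path as soon as consecutive sets differ by a
-- single exchange of points and sets two or more steps apart differ in at least
-- two points.  Given distinct non-adjacent x and y (hence ∣x ─ y∣ ≥ 2) and any w,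
-- walk from x to w and then from w to y, exchanging one point at a time.  Each
-- walk moves points in one direction only, which makes it induced, and ordering
-- the exchanges by how the points sit with respect to x, w and y keeps the sets of
-- the first walk at distance at least two from the later sets of the second.  A single vertex is not, because an induced path from a
-- vertex to itself is trivial, and r ≥ 2, n ≥ r + 2 supply a non-adjacent pair.

module Submission where

open import Defs

open import Data.Bool.Properties using (∧-comm)
open import Data.Fin.Base using (Fin; zero; suc; toℕ; fromℕ; fromℕ<)
open import Data.Fin.Properties using (suc-injective; toℕ-injective; toℕ<n; toℕ-fromℕ; toℕ-fromℕ<)
open import Data.Fin.Subset
open import Data.Fin.Subset.Properties
open import Data.List.Base as List using (List; []; _∷_; _++_; _∷ʳ_; length; take; drop; _∷ʳ′_; initLast)
open import Data.List.Membership.Propositional using () renaming (_∈_ to _∈ˡ_; _∉_ to _∉ˡ_)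
open import Data.List.Membership.Propositional.Properties using (∈-map⁺; ∈-map⁻; ∈-++⁺ˡ; ∈-++⁺ʳ)
open import Data.List.Properties using (length-map; length-++; take-all; ++-assoc; ++-identityʳ)
open import Data.List.Relation.Unary.All as All using (All; []; _∷_)
import Data.List.Relation.Unary.All.Properties as All
open import Data.List.Relation.Unary.AllPairs as AllPairs using ([]; _∷_)
open import Data.List.Relation.Unary.Any using (here; there)
open import Data.List.Relation.Unary.Unique.Propositional using (Unique)
import Data.List.Relation.Unary.Unique.Propositional.Properties as Unique
open import Data.Nat.Base using (ℕ; zero; suc; _+_; _∸_; _≤_; _<_; z≤n; s≤s)
open import Data.Nat.Properties using (_≤?_)
import Data.Nat.Properties as ℕ
open import Data.Product.Base using (Σ-syntax; _×_; _,_; proj₁; proj₂)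
open import Data.Sum.Base using (_⊎_; inj₁; inj₂; [_,_]′)
open import Data.Vec.Base using ([]; _∷_) renaming (here to hereᵛ; there to thereᵛ)
open import Function.Base using (_∘_; id)
open import Function.Bundles using (mk⇔)
open import Relation.Binary.PropositionalEquality
open import Relation.Nullary.Decidable.Core using (yes; no; toSum)
open import Relation.Nullary.Negation using (¬_; contradiction)

private variable
  A : Set
  n : ℕ
  p q s : Subset n
  x y z : Fin n
  xs ys : List A

∣p∣≡∣p∩q∣+∣p─q∣ : ∀ (p q : Subset n) → ∣ p ∣ ≡ ∣ p ∩ q ∣ + ∣ p ─ q ∣
∣p∣≡∣p∩q∣+∣p─q∣ []            []            = refl
∣p∣≡∣p∩q∣+∣p─q∣ (outside ∷ p) (inside ∷ q)  = ∣p∣≡∣p∩q∣+∣p─q∣ p q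
∣p∣≡∣p∩q∣+∣p─q∣ (outside ∷ p) (outside ∷ q) = ∣p∣≡∣p∩q∣+∣p─q∣ p q
∣p∣≡∣p∩q∣+∣p─q∣ (inside ∷ p)  (inside ∷ q)  = cong suc (∣p∣≡∣p∩q∣+∣p─q∣ p q)
∣p∣≡∣p∩q∣+∣p─q∣ (inside ∷ p)  (outside ∷ q) =
  trans (cong suc (∣p∣≡∣p∩q∣+∣p─q∣ p q)) (sym (ℕ.+-suc ∣ p ∩ q ∣ ∣ p ─ q ∣))

∣p∣≡∣q∣⇒∣p─q∣≡∣q─p∣ : ∀ (p q : Subset n) → ∣ p ∣ ≡ ∣ q ∣ → ∣ p ─ q ∣ ≡ ∣ q ─ p ∣
∣p∣≡∣q∣⇒∣p─q∣≡∣q─p∣ p q ∣p∣≡∣q∣ = ℕ.+-cancelˡ-≡ ∣ p ∩ q ∣ _ _ (begin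
  ∣ p ∩ q ∣ + ∣ p ─ q ∣ ≡⟨ ∣p∣≡∣p∩q∣+∣p─q∣ p q ⟨
  ∣ p ∣                 ≡⟨ ∣p∣≡∣q∣ ⟩
  ∣ q ∣                 ≡⟨ ∣p∣≡∣p∩q∣+∣p─q∣ q p ⟩
  ∣ q ∩ p ∣ + ∣ q ─ p ∣ ≡⟨ cong (λ s → ∣ s ∣ + ∣ q ─ p ∣) (∩-comm q p) ⟩
  ∣ p ∩ q ∣ + ∣ q ─ p ∣ ∎)
  where open ≡-Reasoning

∣p─p∣≡0 : ∀ (p : Subset n) → ∣ p ─ p ∣ ≡ 0
∣p─p∣≡0 []            = refl
∣p─p∣≡0 (inside ∷ p)  = ∣p─p∣≡0 p
∣p─p∣≡0 (outside ∷ p) = ∣p─p∣≡0 p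

x∈p─q⇒x∉q : x ∈ p ─ q → x ∉ q
x∈p─q⇒x∉q {p = _ ∷ p} {q = outside ∷ q} hereᵛ        ()
x∈p─q⇒x∉q {p = _ ∷ p} {q = inside ∷ q}  (thereᵛ x∈p─q) (thereᵛ x∈q) = x∈p─q⇒x∉q x∈p─q x∈q
x∈p─q⇒x∉q {p = _ ∷ p} {q = outside ∷ q} (thereᵛ x∈p─q) (thereᵛ x∈q) = x∈p─q⇒x∉q x∈p─q x∈q

x∈p⇒1≤∣p∣ : x ∈ p → 1 ≤ ∣ p ∣
x∈p⇒1≤∣p∣ hereᵛ = s≤s z≤n
x∈p⇒1≤∣p∣ {p = outside ∷ p} (thereᵛ x∈p) = x∈p⇒1≤∣p∣ x∈p
x∈p⇒1≤∣p∣ {p = inside ∷ p}  (thereᵛ x∈p) = s≤s z≤n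

∣p─q∣≡0⇒p⊆q : ∣ p ─ q ∣ ≡ 0 → p ⊆ q
∣p─q∣≡0⇒p⊆q {q = q} ∣p─q∣≡0 {z} z∈p with z ∈? q
... | yes z∈q = z∈q
... | no  z∉q = contradiction (subst (1 ≤_) ∣p─q∣≡0 (x∈p⇒1≤∣p∣ (x∈p∧x∉q⇒x∈p─q z∈p z∉q))) λ ()

x∈p⇒suc∣p-x∣≡∣p∣ : x ∈ p → suc ∣ p - x ∣ ≡ ∣ p ∣
x∈p⇒suc∣p-x∣≡∣p∣ {p = _ ∷ p} hereᵛ = cong (suc ∘ ∣_∣) (p─⊥≡p p)
x∈p⇒suc∣p-x∣≡∣p∣ {p = outside ∷ p} (thereᵛ x∈p) = x∈p⇒suc∣p-x∣≡∣p∣ x∈p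
x∈p⇒suc∣p-x∣≡∣p∣ {p = inside ∷ p}  (thereᵛ x∈p) = cong suc (x∈p⇒suc∣p-x∣≡∣p∣ x∈p)

x∉p⇒∣p∪⁅x⁆∣≡suc∣p∣ : ∀ {n} {p : Subset n} {x} → x ∉ p → ∣ p ∪ ⁅ x ⁆ ∣ ≡ suc ∣ p ∣
x∉p⇒∣p∪⁅x⁆∣≡suc∣p∣ {p = outside ∷ p} {x = zero} x∉p = cong (suc ∘ ∣_∣) (∪-identityʳ p)
x∉p⇒∣p∪⁅x⁆∣≡suc∣p∣ {p = inside ∷ p}  {x = zero} x∉p = contradiction hereᵛ x∉p
x∉p⇒∣p∪⁅x⁆∣≡suc∣p∣ {p = outside ∷ p} {x = suc x} x∉p = x∉p⇒∣p∪⁅x⁆∣≡suc∣p∣ (x∉p ∘ thereᵛ)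
x∉p⇒∣p∪⁅x⁆∣≡suc∣p∣ {p = inside ∷ p}  {x = suc x} x∉p = cong suc (x∉p⇒∣p∪⁅x⁆∣≡suc∣p∣ (x∉p ∘ thereᵛ))

x∈p∧y∈p∧x≢y⇒2≤∣p∣ : x ∈ p → y ∈ p → x ≢ y → 2 ≤ ∣ p ∣
x∈p∧y∈p∧x≢y⇒2≤∣p∣ x∈p y∈p x≢y = subst (2 ≤_) (x∈p⇒suc∣p-x∣≡∣p∣ x∈p)
  (s≤s (x∈p⇒1≤∣p∣ (x∈p∧x≢y⇒x∈p-y y∈p (x≢y ∘ sym))))

p─q∩r≡r─q∩p : ∀ (p q r : Subset n) → (p ─ q) ∩ r ≡ (r ─ q) ∩ p
p─q∩r≡r─q∩p []      []            []      = refl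
p─q∩r≡r─q∩p (a ∷ p) (inside ∷ q)  (c ∷ r) = cong (outside ∷_) (p─q∩r≡r─q∩p p q r)
p─q∩r≡r─q∩p (a ∷ p) (outside ∷ q) (c ∷ r) = cong₂ _∷_ (∧-comm a c) (p─q∩r≡r─q∩p p q r)

∈-[p─q]∩s⁻ : ∀ {p q s : Subset n} → z ∈ (p ─ q) ∩ s → z ∈ p × z ∉ q × z ∈ s
∈-[p─q]∩s⁻ {p = p} {q} {s} z∈ with x∈p∩q⁻ (p ─ q) s z∈
... | z∈p─q , z∈s = p─q⊆p p q z∈p─q , x∈p─q⇒x∉q z∈p─q , z∈s

∈-p─q─s⁻ : ∀ {p q s : Subset n} → z ∈ p ─ q ─ s → z ∈ p × z ∉ q × z ∉ s
∈-p─q─s⁻ {p = p} {q} {s} z∈ =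
  p─q⊆p p q (p─q⊆p (p ─ q) s z∈) , x∈p─q⇒x∉q (p─q⊆p (p ─ q) s z∈) , x∈p─q⇒x∉q z∈

∈-[p─q]∩s⁺ : ∀ {p q s : Subset n} → z ∈ p → z ∉ q → z ∈ s → z ∈ (p ─ q) ∩ s
∈-[p─q]∩s⁺ z∈p z∉q z∈s = x∈p∩q⁺ (x∈p∧x∉q⇒x∈p─q z∈p z∉q , z∈s)

∈-p─q─s⁺ : ∀ {p q s : Subset n} → z ∈ p → z ∉ q → z ∉ s → z ∈ p ─ q ─ s
∈-p─q─s⁺ z∈p z∉q z∉s = x∈p∧x∉q⇒x∈p─q (x∈p∧x∉q⇒x∈p─q z∈p z∉q) z∉s

∈∉⇒≢ : z ∈ s → x ∉ s → z ≢ x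
∈∉⇒≢ z∈s x∉s refl = x∉s z∈s

elements : Subset n → List (Fin n)
elements []            = []
elements (inside ∷ p)  = zero ∷ List.map suc (elements p)
elements (outside ∷ p) = List.map suc (elements p)

∈-elements⁺ : x ∈ p → x ∈ˡ elements p
∈-elements⁺ {p = inside ∷ p}  hereᵛ         = here refl
∈-elements⁺ {p = inside ∷ p}  (thereᵛ x∈p) = there (∈-map⁺ suc (∈-elements⁺ x∈p))
∈-elements⁺ {p = outside ∷ p} (thereᵛ x∈p) = ∈-map⁺ suc (∈-elements⁺ x∈p)

∈-elements⁻ : x ∈ˡ elements p → x ∈ p
∈-elements⁻ {p = inside ∷ p}  (here refl) = hereᵛ
∈-elements⁻ {p = inside ∷ p}  (there x∈)  with ∈-map⁻ suc x∈
... | _ , x∈′ , refl = thereᵛ (∈-elements⁻ x∈′)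
∈-elements⁻ {p = outside ∷ p} x∈          with ∈-map⁻ suc x∈
... | _ , x∈′ , refl = thereᵛ (∈-elements⁻ x∈′)

elements-unique : ∀ (p : Subset n) → Unique (elements p)
elements-unique []            = []
elements-unique (inside ∷ p)  =
  All.¬Any⇒All¬ _ zero∉ ∷ Unique.map⁺ suc-injective (elements-unique p)
  where
  zero∉ : zero ∉ˡ List.map suc (elements p)
  zero∉ 0∈ with ∈-map⁻ suc 0∈
  ... | _ , _ , ()
elements-unique (outside ∷ p) = Unique.map⁺ suc-injective (elements-unique p)

length-elements : ∀ (p : Subset n) → length (elements p) ≡ ∣ p ∣
length-elements []            = refl
length-elements (inside ∷ p)  = cong suc (trans (length-map suc (elements p)) (length-elements p))
length-elements (outside ∷ p) = trans (length-map suc (elements p)) (length-elements p)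

length-elements-++ : ∀ (a b : Subset n) → length (elements a ++ elements b) ≡ ∣ a ∣ + ∣ b ∣
length-elements-++ a b =
  trans (length-++ (elements a)) (cong₂ _+_ (length-elements a) (length-elements b))

unique-elements-++ : ∀ (a b : Subset n) → (∀ {z} → z ∈ˡ elements a → z ∉ˡ elements b) →
                     Unique (elements a ++ elements b)
unique-elements-++ a b disjoint =
  Unique.++⁺ (elements-unique a) (elements-unique b) (λ (z∈a , z∈b) → disjoint z∈a z∈b)

∈-drop-++ˡ : ∀ (xs : List A) {ys z} i → z ∈ˡ drop i xs → z ∈ˡ drop i (xs ++ ys)
∈-drop-++ˡ xs       zero    z∈ = ∈-++⁺ˡ z∈
∈-drop-++ˡ (x ∷ xs) (suc i) z∈ = ∈-drop-++ˡ xs i z∈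

∈-drop-last : ∀ (xs ys : List A) {z} i → i < length (xs ++ (ys ∷ʳ z)) →
              z ∈ˡ drop i (xs ++ (ys ∷ʳ z))
∈-drop-last (x ∷ xs) ys       zero    _        = there (∈-++⁺ʳ xs (∈-++⁺ʳ ys (here refl)))
∈-drop-last (x ∷ xs) ys       (suc i) (s≤s i<) = ∈-drop-last xs ys i i<
∈-drop-last []       (y ∷ ys) zero    _        = there (∈-++⁺ʳ ys (here refl))
∈-drop-last []       (y ∷ ys) (suc i) (s≤s i<) = ∈-drop-last [] ys i i<
∈-drop-last []       []       zero    _        = here refl
∈-drop-last []       []       (suc i) (s≤s ())

length-++-∷ʳ : ∀ (xs ys : List A) z → length (xs ++ (ys ∷ʳ z)) ≡ suc (length (xs ++ ys))
length-++-∷ʳ (x ∷ xs) ys       z = cong suc (length-++-∷ʳ xs ys z)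
length-++-∷ʳ []       (y ∷ ys) z = cong suc (length-++-∷ʳ [] ys z)
length-++-∷ʳ []       []       z = refl

unique-++ʳ : ∀ (xs : List A) {ys} → Unique (xs ++ ys) → Unique ys
unique-++ʳ []       u       = u
unique-++ʳ (x ∷ xs) (_ ∷ u) = unique-++ʳ xs u

unique-∷ʳ : ∀ {xs : List A} {y z} → Unique (xs ∷ʳ z) → y ∈ˡ xs → y ≢ z
unique-∷ʳ {xs = x ∷ xs} (x∉ ∷ _) (here refl) = All.lookup x∉ (∈-++⁺ʳ xs (here refl))
unique-∷ʳ {xs = x ∷ xs} (_ ∷ u)  (there y∈) = unique-∷ʳ u y∈

-- Exchanging points

exchange : Subset n → Fin n → Fin n → Subset n
exchange p x y = (p - x) ∪ ⁅ y ⁆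

∈-exchange⁺ : z ∈ p → z ≢ x → z ∈ exchange p x y
∈-exchange⁺ z∈p z≢x = x∈p∪q⁺ (inj₁ (x∈p∧x≢y⇒x∈p-y z∈p z≢x))

y∈exchange : y ∈ exchange p x y
y∈exchange {y = y} = x∈p∪q⁺ (inj₂ (x∈⁅x⁆ y))

∈-exchange⁻ : z ∈ exchange p x y → (z ∈ p × z ≢ x) ⊎ z ≡ y
∈-exchange⁻ {p = p} {x = x} {y = y} z∈ with x∈p∪q⁻ (p - x) ⁅ y ⁆ z∈
... | inj₁ z∈p-x = inj₁ (p─q⊆p p ⁅ x ⁆ z∈p-x , x∉⁅y⁆⇒x≢y (x∈p─q⇒x∉q z∈p-x))
... | inj₂ z∈⁅y⁆ = inj₂ (x∈⁅y⁆⇒x≡y y z∈⁅y⁆)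

∉-exchange : z ∉ p → z ≢ y → z ∉ exchange p x y
∉-exchange z∉p z≢y z∈ with ∈-exchange⁻ z∈
... | inj₁ (z∈p , _) = z∉p z∈p
... | inj₂ z≡y       = z≢y z≡y

x∉exchange : x ≢ y → x ∉ exchange p x y
x∉exchange x≢y x∈ with ∈-exchange⁻ x∈
... | inj₁ (_ , x≢x) = x≢x refl
... | inj₂ x≡y       = x≢y x≡y

∣exchange∣ : x ∈ p → y ∉ p → ∣ exchange p x y ∣ ≡ ∣ p ∣
∣exchange∣ {x = x} {p = p} x∈p y∉p =
  trans (x∉p⇒∣p∪⁅x⁆∣≡suc∣p∣ (y∉p ∘ p─q⊆p p ⁅ x ⁆)) (x∈p⇒suc∣p-x∣≡∣p∣ x∈p)

p∩exchange≡p-x : y ∉ p → p ∩ exchange p x y ≡ p - x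
p∩exchange≡p-x {y = y} {p = p} {x = x} y∉p = ⊆-antisym ⊆-p-x ⊇-p-x
  where
  ⊆-p-x : p ∩ exchange p x y ⊆ p - x
  ⊆-p-x z∈ with x∈p∩q⁻ p (exchange p x y) z∈
  ... | z∈p , z∈ex with ∈-exchange⁻ z∈ex
  ...   | inj₁ (_ , z≢x) = x∈p∧x≢y⇒x∈p-y z∈p z≢x
  ...   | inj₂ refl      = contradiction z∈p y∉p
  ⊇-p-x : p - x ⊆ p ∩ exchange p x y
  ⊇-p-x z∈p-x = x∈p∩q⁺ (z∈p , ∈-exchange⁺ z∈p (x∉⁅y⁆⇒x≢y (x∈p─q⇒x∉q z∈p-x)))
    where z∈p = p─q⊆p p ⁅ x ⁆ z∈p-x

∣p∩exchange∣ : x ∈ p → y ∉ p → ∣ p ∩ exchange p x y ∣ ≡ ∣ p ∣ ∸ 1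
∣p∩exchange∣ x∈p y∉p =
  trans (cong ∣_∣ (p∩exchange≡p-x y∉p)) (cong (_∸ 1) (x∈p⇒suc∣p-x∣≡∣p∣ x∈p))

exchanges : Subset n → List (Fin n) → List (Fin n) → ℕ → Subset n
exchanges p xs       ys       zero    = p
exchanges p (x ∷ xs) (y ∷ ys) (suc i) = exchanges (exchange p x y) xs ys i
exchanges p _        _        (suc i) = p

record Exchangeable (p : Subset n) (xs ys : List (Fin n)) : Set where
  field
    same-length : length xs ≡ length ys
    leaving-unique  : Unique xs
    entering-unique : Unique ys
    leaving⊆  : All (_∈ p) xs
    entering∉ : All (_∉ p) ys

  leaving∌ : z ∉ p → z ∉ˡ xs
  leaving∌ z∉p z∈xs = z∉p (All.lookup leaving⊆ z∈xs)

  entering∌ : z ∈ p → z ∉ˡ ys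
  entering∌ z∈p z∈ys = All.lookup entering∉ z∈ys z∈p

exchangeable-step : Exchangeable p (x ∷ xs) (y ∷ ys) → Exchangeable (exchange p x y) xs ys
exchangeable-step e = record
  { same-length = ℕ.suc-injective same-length
  ; leaving-unique  = tail leaving-unique
  ; entering-unique = tail entering-unique
  ; leaving⊆  = All.zipWith (λ (z∈p , x≢z) → ∈-exchange⁺ z∈p (x≢z ∘ sym))
                            (All.tail leaving⊆ , head leaving-unique)
  ; entering∉ = All.zipWith (λ (z∉p , y≢z) → ∉-exchange z∉p (y≢z ∘ sym))
                            (All.tail entering∉ , head entering-unique)
  }
  where
  open Exchangeable e
  open import Data.List.Relation.Unary.AllPairs using (head; tail)

open Exchangeable

∣exchanges∣ : Exchangeable p xs ys → ∀ i → ∣ exchanges p xs ys i ∣ ≡ ∣ p ∣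
∣exchanges∣                         e zero    = refl
∣exchanges∣ {xs = []}               e (suc i) = refl
∣exchanges∣ {xs = _ ∷ _} {ys = []}  e (suc i) = refl
∣exchanges∣ {xs = _ ∷ _} {ys = _ ∷ _} e (suc i) =
  trans (∣exchanges∣ (exchangeable-step e) i)
        (∣exchange∣ (All.head (leaving⊆ e)) (All.head (entering∉ e)))

∈-exchanges-kept : Exchangeable p xs ys → z ∈ p → z ∉ˡ xs → ∀ i → z ∈ exchanges p xs ys i
∈-exchanges-kept                           e z∈p z∉xs zero    = z∈p
∈-exchanges-kept {xs = []}                 e z∈p z∉xs (suc i) = z∈p
∈-exchanges-kept {xs = _ ∷ _} {ys = []}    e z∈p z∉xs (suc i) = z∈p
∈-exchanges-kept {xs = _ ∷ _} {ys = _ ∷ _} e z∈p z∉xs (suc i) =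
  ∈-exchanges-kept (exchangeable-step e) (∈-exchange⁺ z∈p (z∉xs ∘ here)) (z∉xs ∘ there) i

∉-exchanges-kept : Exchangeable p xs ys → z ∉ p → z ∉ˡ ys → ∀ i → z ∉ exchanges p xs ys i
∉-exchanges-kept                           e z∉p z∉ys zero    = z∉p
∉-exchanges-kept {xs = []}                 e z∉p z∉ys (suc i) = z∉p
∉-exchanges-kept {xs = _ ∷ _} {ys = []}    e z∉p z∉ys (suc i) = z∉p
∉-exchanges-kept {xs = _ ∷ _} {ys = _ ∷ _} e z∉p z∉ys (suc i) =
  ∉-exchanges-kept (exchangeable-step e) (∉-exchange z∉p (z∉ys ∘ here)) (z∉ys ∘ there) i

∈-exchanges-entered : Exchangeable p xs ys → ∀ i → z ∈ˡ take i ys → z ∈ exchanges p xs ys i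
∈-exchanges-entered {xs = []}    {ys = _ ∷ _} e (suc i) _ with () ← same-length e
∈-exchanges-entered {xs = x ∷ _} {ys = y ∷ _} e (suc i) (here refl) =
  ∈-exchanges-kept (exchangeable-step e) y∈exchange (leaving∌ e (All.head (entering∉ e)) ∘ there) i
∈-exchanges-entered {xs = _ ∷ _} {ys = _ ∷ _} e (suc i) (there z∈) =
  ∈-exchanges-entered (exchangeable-step e) i z∈

∉-exchanges-entering : Exchangeable p xs ys → ∀ i → z ∈ˡ drop i ys → z ∉ exchanges p xs ys i
∉-exchanges-entering                           e zero    z∈ = All.lookup (entering∉ e) z∈
∉-exchanges-entering {xs = []}    {ys = _ ∷ _} e (suc i) _  with () ← same-length e
∉-exchanges-entering {xs = _ ∷ _} {ys = _ ∷ _} e (suc i) z∈ =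
  ∉-exchanges-entering (exchangeable-step e) i z∈

∉-exchanges-left : Exchangeable p xs ys → ∀ i → z ∈ˡ take i xs → z ∉ exchanges p xs ys i
∉-exchanges-left {xs = _ ∷ _} {ys = []}    e (suc i) _ with () ← same-length e
∉-exchanges-left {xs = x ∷ _} {ys = y ∷ _} e (suc i) (here refl) =
  ∉-exchanges-kept (exchangeable-step e) (x∉exchange x≢y) (entering∌ e x∈p ∘ there) i
  where
  x∈p = All.head (leaving⊆ e)
  x≢y : x ≢ y
  x≢y refl = All.head (entering∉ e) x∈p
∉-exchanges-left {xs = _ ∷ _} {ys = _ ∷ _} e (suc i) (there z∈) =
  ∉-exchanges-left (exchangeable-step e) i z∈

∈-exchanges-leaving : Exchangeable p xs ys → ∀ i → z ∈ˡ drop i xs → z ∈ exchanges p xs ys i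
∈-exchanges-leaving                           e zero    z∈ = All.lookup (leaving⊆ e) z∈
∈-exchanges-leaving {xs = _ ∷ _} {ys = []}    e (suc i) _  with () ← same-length e
∈-exchanges-leaving {xs = _ ∷ _} {ys = _ ∷ _} e (suc i) z∈ =
  ∈-exchanges-leaving (exchangeable-step e) i z∈

∣exchanges∩exchanges∣ : Exchangeable p xs ys → ∀ i → i < length xs →
                        ∣ exchanges p xs ys i ∩ exchanges p xs ys (suc i) ∣ ≡ ∣ p ∣ ∸ 1
∣exchanges∩exchanges∣ {xs = _ ∷ _} {ys = []}    e _       _ with () ← same-length e
∣exchanges∩exchanges∣ {xs = _ ∷ _} {ys = _ ∷ _} e zero    _ =
  ∣p∩exchange∣ (All.head (leaving⊆ e)) (All.head (entering∉ e))
∣exchanges∩exchanges∣ {xs = _ ∷ _} {ys = _ ∷ _} e (suc i) (s≤s i<) =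
  trans (∣exchanges∩exchanges∣ (exchangeable-step e) i i<)
        (cong (_∸ 1) (∣exchange∣ (All.head (leaving⊆ e)) (All.head (entering∉ e))))

exchanges-apart : Exchangeable p xs ys → ∀ i j → 2 + i ≤ j → j ≤ length xs →
                  2 ≤ ∣ exchanges p xs ys j ─ exchanges p xs ys i ∣
exchanges-apart e zero j 2≤j j≤ =
  first-two-entered e j (ℕ.≤-trans 2≤j (ℕ.≤-trans j≤ (ℕ.≤-reflexive (same-length e)))) 2≤j
  where
  first-two-entered : Exchangeable p xs ys → ∀ j → 2 ≤ length ys → 2 ≤ j →
                      2 ≤ ∣ exchanges p xs ys j ─ p ∣
  first-two-entered {ys = y ∷ y′ ∷ _} e (suc (suc j)) _ _ = x∈p∧y∈p∧x≢y⇒2≤∣p∣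
    (x∈p∧x∉q⇒x∈p─q (∈-exchanges-entered e _ (here refl)) (All.head (entering∉ e)))
    (x∈p∧x∉q⇒x∈p─q (∈-exchanges-entered e _ (there (here refl))) (All.head (All.tail (entering∉ e))))
    (All.head (AllPairs.head (entering-unique e)))
  first-two-entered {ys = _ ∷ []} e _ (s≤s ()) _
  first-two-entered e (suc zero) _ (s≤s ())
exchanges-apart {xs = []}                 e (suc i) (suc j) _ ()
exchanges-apart {xs = _ ∷ _} {ys = []}    e (suc i) _ _ _ with () ← same-length e
exchanges-apart {xs = _ ∷ _} {ys = _ ∷ _} e (suc i) (suc j) (s≤s 2+i≤j) (s≤s j≤) =
  exchanges-apart (exchangeable-step e) i j 2+i≤j j≤

exchanges-end : Exchangeable p xs ys → All (_∉ q) xs → All (_∈ q) ys →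
                (∀ {z} → z ∈ p → z ∉ q → z ∈ˡ xs) → (∀ {z} → z ∈ q → z ∉ p → z ∈ˡ ys) →
                exchanges p xs ys (length xs) ≡ q
exchanges-end {p = p} {xs = xs} {ys = ys} {q = q} e xs∉q ys∈q p─q⊆xs q─p⊆ys = ⊆-antisym ⊆q ⊇q
  where
  final = exchanges p xs ys (length xs)
  all-left : z ∈ˡ xs → z ∈ˡ take (length xs) xs
  all-left = subst (_ ∈ˡ_) (sym (take-all (length xs) xs ℕ.≤-refl))
  all-entered : z ∈ˡ ys → z ∈ˡ take (length xs) ys
  all-entered = subst (_ ∈ˡ_) (sym (take-all (length xs) ys (ℕ.≤-reflexive (sym (same-length e)))))
  ⊆q : final ⊆ q
  ⊆q {z} z∈ with z ∈? q | z ∈? p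
  ... | yes z∈q | _       = z∈q
  ... | no z∉q  | yes z∈p = contradiction z∈ (∉-exchanges-left e (length xs) (all-left (p─q⊆xs z∈p z∉q)))
  ... | no z∉q  | no z∉p  = contradiction z∈ (∉-exchanges-kept e z∉p (z∉q ∘ All.lookup ys∈q) (length xs))
  ⊇q : q ⊆ final
  ⊇q {z} z∈q with z ∈? p
  ... | yes z∈p = ∈-exchanges-kept e z∈p (λ z∈xs → All.lookup xs∉q z∈xs z∈q) (length xs)
  ... | no z∉p  = ∈-exchanges-entered e (length xs) (all-entered (q─p⊆ys z∈q z∉p))

-- Paths of exchanges and induced paths

record ExchangePath (r : ℕ) (F : ℕ → Subset n) (L : ℕ) : Set where
  field
    size     : ∀ t → ∣ F t ∣ ≡ r
    adjacent : ∀ t → t < L → ∣ F t ∩ F (suc t) ∣ ≡ r ∸ 1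
    apart    : ∀ s t → 2 + s ≤ t → t ≤ L → 2 ≤ ∣ F t ─ F s ∣

exchanges-path : Exchangeable p xs ys → ExchangePath ∣ p ∣ (exchanges p xs ys) (length xs)
exchanges-path e = record
  { size     = ∣exchanges∣ e
  ; adjacent = ∣exchanges∩exchanges∣ e
  ; apart    = exchanges-apart e
  }

module _ {A : Set} where

  glue : ℕ → (ℕ → A) → (ℕ → A) → ℕ → A
  glue zero    f g t       = g t
  glue (suc k) f g zero    = f zero
  glue (suc k) f g (suc t) = glue k (f ∘ suc) g t

  glue-≤ : ∀ {k t} {f g : ℕ → A} → f k ≡ g 0 → t ≤ k → glue k f g t ≡ f t
  glue-≤ {zero}  {zero}  fk≡g0 _         = sym fk≡g0
  glue-≤ {suc k} {zero}  fk≡g0 _         = refl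
  glue-≤ {suc k} {suc t} fk≡g0 (s≤s t≤k) = glue-≤ fk≡g0 t≤k

  glue-+ : ∀ k t {f g : ℕ → A} → glue k f g (k + t) ≡ g t
  glue-+ zero    t = refl
  glue-+ (suc k) t = glue-+ k t

  glue-preserves : ∀ {P : A → Set} k {f g} → (∀ t → P (f t)) → (∀ t → P (g t)) →
                   ∀ t → P (glue k f g t)
  glue-preserves zero    Pf Pg t       = Pg t
  glue-preserves (suc k) Pf Pg zero    = Pf zero
  glue-preserves {P} (suc k) Pf Pg (suc t) = glue-preserves {P} k (Pf ∘ suc) Pg t

data Split (k : ℕ) : ℕ → Set where
  before : ∀ {t} → t < k → Split k t
  after  : ∀ t → Split k (k + t)

split : ∀ k t → Split k t
split zero    t       = after t
split (suc k) zero    = before (s≤s z≤n)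
split (suc k) (suc t) with split k t
... | before t<k = before (s≤s t<k)
... | after t    = after t

glue-path : ∀ {r k m} {F G : ℕ → Subset n} →
            ExchangePath r F k → ExchangePath r G m → F k ≡ G 0 →
            (∀ s t → s < k → 0 < t → t ≤ m → 2 ≤ ∣ G t ─ F s ∣) →
            ExchangePath r (glue k F G) (k + m)
glue-path {n} {r} {k} {m} {F} {G} PF PG Fk≡G0 cross = record
  { size     = glue-preserves {P = λ s → ∣ s ∣ ≡ r} k (size PF) (size PG)
  ; adjacent = adjacent′
  ; apart    = apart′
  }
  where
  open ExchangePath
  H = glue k F G

  H-F : ∀ {t} → t ≤ k → H t ≡ F t
  H-F = glue-≤ Fk≡G0

  H-G : ∀ t → H (k + t) ≡ G t
  H-G t = glue-+ k t

  H-G-suc : ∀ t → H (suc (k + t)) ≡ G (suc t)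
  H-G-suc t = trans (cong H (sym (ℕ.+-suc k t))) (H-G (suc t))

  ∩-via : ∀ {a a′ b b′ : Subset n} → a ≡ a′ → b ≡ b′ → ∣ a′ ∩ b′ ∣ ≡ r ∸ 1 → ∣ a ∩ b ∣ ≡ r ∸ 1
  ∩-via refl refl = id

  ─-via : ∀ {a a′ b b′ : Subset n} → a ≡ a′ → b ≡ b′ → 2 ≤ ∣ a′ ─ b′ ∣ → 2 ≤ ∣ a ─ b ∣
  ─-via refl refl = id

  adjacent′ : ∀ t → t < k + m → ∣ H t ∩ H (suc t) ∣ ≡ r ∸ 1
  adjacent′ t t< with split k t
  ... | before t<k = ∩-via (H-F (ℕ.<⇒≤ t<k)) (H-F t<k) (adjacent PF t t<k)
  ... | after t′   = ∩-via (H-G t′) (H-G-suc t′) (adjacent PG t′ (ℕ.+-cancelˡ-< k t′ m t<))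

  apart′ : ∀ s t → 2 + s ≤ t → t ≤ k + m → 2 ≤ ∣ H t ─ H s ∣
  apart′ s t 2+s≤t t≤ with split k t | split k s
  ... | before t<k     | _          = ─-via (H-F (ℕ.<⇒≤ t<k)) (H-F s≤k) (apart PF s t 2+s≤t (ℕ.<⇒≤ t<k))
    where s≤k = ℕ.≤-trans (ℕ.m≤n+m s 2) (ℕ.≤-trans 2+s≤t (ℕ.<⇒≤ t<k))
  ... | after zero     | before s<k = ─-via (trans (H-G 0) (sym Fk≡G0)) (H-F (ℕ.<⇒≤ s<k))
                                        (apart PF s k (subst (2 + s ≤_) (ℕ.+-identityʳ k) 2+s≤t) ℕ.≤-refl)
  ... | after (suc t′) | before s<k = ─-via (H-G (suc t′)) (H-F (ℕ.<⇒≤ s<k))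
                                        (cross s (suc t′) s<k (s≤s z≤n) (ℕ.+-cancelˡ-≤ k _ _ t≤))
  ... | after t′       | after s′   = ─-via (H-G t′) (H-G s′)
                                        (apart PG s′ t′ (ℕ.+-cancelˡ-≤ k _ _ (subst (_≤ k + t′) (shift s′) 2+s≤t))
                                                        (ℕ.+-cancelˡ-≤ k _ _ t≤))
    where
    shift : ∀ s′ → 2 + (k + s′) ≡ k + (2 + s′)
    shift s′ = sym (trans (ℕ.+-suc k (suc s′)) (cong suc (ℕ.+-suc k s′)))

data Gap : ℕ → ℕ → Set where
  equal : ∀ {s} → Gap s s
  next  : ∀ {s} → Gap s (suc s)
  prev  : ∀ {t} → Gap (suc t) t
  far→  : ∀ {s t} → 2 + s ≤ t → Gap s t
  far←  : ∀ {s t} → 2 + t ≤ s → Gap s t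

gap : ∀ s t → Gap s t
gap zero          zero          = equal
gap zero          (suc zero)    = next
gap zero          (suc (suc t)) = far→ (s≤s (s≤s z≤n))
gap (suc zero)    zero          = prev
gap (suc (suc s)) zero          = far← (s≤s (s≤s z≤n))
gap (suc s)       (suc t)       with gap s t
... | equal       = equal
... | next        = next
... | prev        = prev
... | far→ 2+s≤t = far→ (s≤s 2+s≤t)
... | far← 2+t≤s = far← (s≤s 2+t≤s)

module _ (G : Graph) (adj-sym : ∀ {u v} → Adj G u v → Adj G v u) (adj-irrefl : ∀ {v} → ¬ Adj G v v)
         (f : ℕ → V G) (L : ℕ)
         (consecutive : ∀ t → t < L → Adj G (f t) (f (suc t)))
         (distant : ∀ s t → 2 + s ≤ t → t ≤ L → f s ≢ f t × ¬ Adj G (f s) (f t)) where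

  private
    adjacent⇒next : ∀ {s t} → s ≤ L → t ≤ L → Adj G (f s) (f t) → t ≡ suc s ⊎ s ≡ suc t
    adjacent⇒next {s} {t} s≤L t≤L a with gap s t
    ... | equal      = contradiction a adj-irrefl
    ... | next       = inj₁ refl
    ... | prev       = inj₂ refl
    ... | far→ 2+s≤t = contradiction a (proj₂ (distant s t 2+s≤t t≤L))
    ... | far← 2+t≤s = contradiction (adj-sym a) (proj₂ (distant t s 2+t≤s s≤L))

    next⇒adjacent : ∀ {s t} → s ≤ L → t ≤ L → t ≡ suc s ⊎ s ≡ suc t → Adj G (f s) (f t)
    next⇒adjacent s≤L t≤L (inj₁ refl) = consecutive _ t≤L
    next⇒adjacent s≤L t≤L (inj₂ refl) = adj-sym (consecutive _ s≤L)

    injective : ∀ {s t} → s ≤ L → t ≤ L → f s ≡ f t → s ≡ t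
    injective {s} {t} s≤L t≤L fs≡ft with gap s t
    ... | equal      = refl
    ... | next       = contradiction (subst (Adj G (f s)) (sym fs≡ft) (consecutive s t≤L)) adj-irrefl
    ... | prev       = contradiction (subst (Adj G (f t)) fs≡ft (consecutive t s≤L)) adj-irrefl
    ... | far→ 2+s≤t = contradiction fs≡ft (proj₁ (distant s t 2+s≤t t≤L))
    ... | far← 2+t≤s = contradiction (sym fs≡ft) (proj₁ (distant t s 2+t≤s s≤L))

    bound : (i : Fin (suc L)) → toℕ i ≤ L
    bound i = ℕ.≤-pred (toℕ<n i)

    path : InducedPath G (f 0) (f L)
    path = record
      { len      = L
      ; vert     = f ∘ toℕ
      ; distinct = λ {i} {j} → toℕ-injective ∘ injective (bound i) (bound j)
      ; start    = zero , refl , refl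
      ; end      = fromℕ L , toℕ-fromℕ L , cong f (toℕ-fromℕ L)
      ; induced  = λ i j → mk⇔ (adjacent⇒next (bound i) (bound j))
                               (next⇒adjacent (bound i) (bound j))
      }

  on-induced-path : ∀ {u v w} → f 0 ≡ u → f L ≡ v → ∀ t → t ≤ L → f t ≡ w → OnInducedPath G u v w
  on-induced-path refl refl t t≤L refl = path , fromℕ< (s≤s t≤L) , cong f (toℕ-fromℕ< (s≤s t≤L))

module _ (G : Graph) where

  interval-diagonal : ∀ {u w} → InInterval G u u w → w ≡ u
  interval-diagonal (inj₁ w≡u)               = w≡u
  interval-diagonal (inj₂ (inj₁ w≡u))        = w≡u
  interval-diagonal (inj₂ (inj₂ (P , i , vert-i≡w))) with InducedPath.start P | InducedPath.end P
  ... | i₀ , i₀≡0 , vert-i₀≡u | i₁ , i₁≡len , vert-i₁≡u =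
    trans (sym vert-i≡w) (trans (cong vert i≡i₀) vert-i₀≡u)
    where
    open InducedPath P
    len≡0 : len ≡ 0
    len≡0 = trans (sym i₁≡len) (trans (cong toℕ (sym (distinct (trans vert-i₀≡u (sym vert-i₁≡u))))) i₀≡0)
    i≡i₀ : i ≡ i₀
    i≡i₀ = toℕ-injective (trans (ℕ.n≤0⇒n≡0 (subst (toℕ i ≤_) len≡0 (ℕ.≤-pred (toℕ<n i)))) (sym i₀≡0))

  monophonic⇒2≤length : ∀ {a b} → a ≢ b → ∀ S → Monophonic G S → 2 ≤ length S
  monophonic⇒2≤length {a} {b} a≢b []          mono with mono a
  ... | _ , _ , () , _
  monophonic⇒2≤length {a} {b} a≢b (s ∷ [])    mono with mono a | mono b
  ... | _ , _ , here refl , here refl , a∈ | _ , _ , here refl , here refl , b∈ =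
    contradiction (trans (interval-diagonal a∈) (sym (interval-diagonal b∈))) a≢b
  monophonic⇒2≤length a≢b (_ ∷ _ ∷ _) mono = s≤s (s≤s z≤n)

-- The detour through a third vertex

-- Lₐᵦ꜀ lists the points whose membership in x, w and y is given by the bits a, b and c.

module Witnesses {x w y : Subset n} (L₁₀₁ L₁₀₀ L₀₁₀ L₀₁₁ L₁₁₀ L₀₀₁ : List (Fin n))
         (E₁ : Exchangeable x (L₁₀₁ ++ L₁₀₀) (L₀₁₀ ++ L₀₁₁))
         (E₂ : Exchangeable w (L₁₁₀ ++ L₀₁₀) (L₀₀₁ ++ L₁₀₁))
         (⊆w : All (_∈ w) (L₀₁₀ ++ L₀₁₁)) (⊆y : All (_∈ y) L₀₁₁)
         (∌y : All (_∉ y) (L₁₁₀ ++ L₀₁₀)) (∌x : All (_∉ x) L₀₀₁) (i j : ℕ) where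

  private
    F₁ = exchanges x (L₁₀₁ ++ L₁₀₀) (L₀₁₀ ++ L₀₁₁) i
    F₂ = exchanges w (L₁₁₀ ++ L₀₁₀) (L₀₀₁ ++ L₁₀₁) j

  witness₁₀₁ : z ∈ˡ take i (L₁₀₁ ++ L₁₀₀) → z ∈ˡ take j (L₀₀₁ ++ L₁₀₁) → z ∈ F₂ ─ F₁
  witness₁₀₁ z∈ z∈′ = x∈p∧x∉q⇒x∈p─q (∈-exchanges-entered E₂ j z∈′) (∉-exchanges-left E₁ i z∈)

  witness₀₁₀ : z ∈ˡ drop i (L₀₁₀ ++ L₀₁₁) → z ∈ˡ drop j (L₁₁₀ ++ L₀₁₀) → z ∈ F₂ ─ F₁
  witness₀₁₀ z∈ z∈′ = x∈p∧x∉q⇒x∈p─q (∈-exchanges-leaving E₂ j z∈′) (∉-exchanges-entering E₁ i z∈)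

  witness₀₀₁ : z ∈ˡ L₀₀₁ → z ∈ˡ take j (L₀₀₁ ++ L₁₀₁) → z ∈ F₂ ─ F₁
  witness₀₀₁ z∈ z∈′ = x∈p∧x∉q⇒x∈p─q (∈-exchanges-entered E₂ j z∈′)
    (∉-exchanges-kept E₁ (All.lookup ∌x z∈) (λ z∈′′ → entering∌ E₂ (All.lookup ⊆w z∈′′) (∈-++⁺ˡ z∈)) i)

  witness₀₁₁ : z ∈ˡ L₀₁₁ → z ∈ˡ drop i (L₀₁₀ ++ L₀₁₁) → z ∈ F₂ ─ F₁
  witness₀₁₁ z∈ z∈′ = x∈p∧x∉q⇒x∈p─q
    (∈-exchanges-kept E₂ (All.lookup ⊆w (∈-++⁺ʳ L₀₁₀ z∈))
                         (λ z∈′′ → All.lookup ∌y z∈′′ (All.lookup ⊆y z∈)) j)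
    (∉-exchanges-entering E₁ i z∈′)

-- Both walks are monotone, so it remains to compare a set F₁ i of the first walk with a set
-- F₂ j of the second.  Points of L₀₁₁ enter the first walk last and never leave the second;
-- points of L₀₀₁ enter the second walk first and never meet the first; and
-- ∣L₀₁₁∣ + ∣L₀₀₁∣ = ∣y ─ x∣ ≥ 2.  When only one such point is available, the first point of
-- L₁₀₁ (the first to leave the first walk, and re-entered by the second) or the last point
-- of L₀₁₀ (the last to enter the first walk and to leave the second) replaces the other.
Crossing : (x w y : Subset n) (L₁₀₁ L₁₀₀ L₀₁₀ L₀₁₁ L₁₁₀ L₀₀₁ : List (Fin n)) → Set
Crossing x w y L₁₀₁ L₁₀₀ L₀₁₀ L₀₁₁ L₁₁₀ L₀₀₁ =
  Exchangeable x (L₁₀₁ ++ L₁₀₀) (L₀₁₀ ++ L₀₁₁) → Exchangeable w (L₁₁₀ ++ L₀₁₀) (L₀₀₁ ++ L₁₀₁) →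
  All (_∈ w) (L₀₁₀ ++ L₀₁₁) → All (_∈ y) L₀₁₁ → All (_∉ y) (L₁₁₀ ++ L₀₁₀) → All (_∉ x) L₀₀₁ →
  ∀ i j → i < length (L₀₁₀ ++ L₀₁₁) → 0 < j → j ≤ length (L₀₀₁ ++ L₁₀₁) →
  2 ≤ ∣ exchanges w (L₁₁₀ ++ L₀₁₀) (L₀₀₁ ++ L₁₀₁) j ─ exchanges x (L₁₀₁ ++ L₁₀₀) (L₀₁₀ ++ L₀₁₁) i ∣

module _ {x w y : Subset n} where

  crossing-via-L₀₁₁-L₀₀₁ : ∀ L₁₀₁ L₁₀₀ L₀₁₀ L₁₁₀ ys v z zs →
                           Crossing x w y L₁₀₁ L₁₀₀ L₀₁₀ (ys ∷ʳ v) L₁₁₀ (z ∷ zs)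
  crossing-via-L₀₁₁-L₀₀₁ L₁₀₁ L₁₀₀ L₀₁₀ L₁₁₀ ys v z zs E₁ E₂ ⊆w ⊆y ∌y ∌x i (suc j) i< _ _ =
    x∈p∧y∈p∧x≢y⇒2≤∣p∣ (witness₀₁₁ v∈ (∈-drop-last L₀₁₀ ys i i<)) (witness₀₀₁ (here refl) (here refl))
      (∈∉⇒≢ (All.lookup ⊆w (∈-++⁺ʳ L₀₁₀ v∈)) (All.head (entering∉ E₂)))
    where
    open Witnesses L₁₀₁ L₁₀₀ L₀₁₀ (ys ∷ʳ v) L₁₁₀ (z ∷ zs) E₁ E₂ ⊆w ⊆y ∌y ∌x i (suc j)
    v∈ = ∈-++⁺ʳ ys (here refl)

  crossing-via-L₀₁₁ : ∀ L₁₀₁ L₁₀₀ L₀₁₀ L₁₁₀ ys v′ v →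
                      Crossing x w y L₁₀₁ L₁₀₀ L₀₁₀ ((ys ∷ʳ v′) ∷ʳ v) L₁₁₀ []
  crossing-via-L₀₁₁ L₁₀₁ L₁₀₀ L₀₁₀ L₁₁₀ ys v′ v E₁ E₂ ⊆w ⊆y ∌y ∌x i j i< _ _
    with 2 + i ≤? length (L₀₁₀ ++ ((ys ∷ʳ v′) ∷ʳ v))
  ... | yes 2+i≤ =
    x∈p∧y∈p∧x≢y⇒2≤∣p∣ (witness₀₁₁ v′∈ v′∈drop) (witness₀₁₁ v∈ (∈-drop-last L₀₁₀ (ys ∷ʳ v′) i i<))
      (unique-∷ʳ (unique-++ʳ L₀₁₀ (entering-unique E₁)) (∈-++⁺ʳ ys (here refl)))
    where
    open Witnesses L₁₀₁ L₁₀₀ L₀₁₀ ((ys ∷ʳ v′) ∷ʳ v) L₁₁₀ [] E₁ E₂ ⊆w ⊆y ∌y ∌x i j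
    v∈ = ∈-++⁺ʳ (ys ∷ʳ v′) (here refl)
    v′∈ = ∈-++⁺ˡ (∈-++⁺ʳ ys (here refl))
    i<′ : i < length (L₀₁₀ ++ (ys ∷ʳ v′))
    i<′ = ℕ.≤-pred (subst (2 + i ≤_) (length-++-∷ʳ L₀₁₀ (ys ∷ʳ v′) v) 2+i≤)
    v′∈drop : v′ ∈ˡ drop i (L₀₁₀ ++ ((ys ∷ʳ v′) ∷ʳ v))
    v′∈drop = subst (λ l → v′ ∈ˡ drop i l) (++-assoc L₀₁₀ (ys ∷ʳ v′) (v ∷ []))
                (∈-drop-++ˡ (L₀₁₀ ++ (ys ∷ʳ v′)) i (∈-drop-last L₀₁₀ ys i i<′))
  crossing-via-L₀₁₁ L₁₀₁ L₁₀₀ L₀₁₀ L₁₁₀ ys v′ v E₁ E₂ ⊆w ⊆y ∌y ∌x zero j _ _ _ | no ¬2≤ =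
    contradiction (subst (2 ≤_) (sym length≡) (s≤s (s≤s z≤n))) ¬2≤
    where
    length≡ = trans (length-++-∷ʳ L₀₁₀ (ys ∷ʳ v′) v) (cong suc (length-++-∷ʳ L₀₁₀ ys v′))
  crossing-via-L₀₁₁ (p ∷ ps) L₁₀₀ L₀₁₀ L₁₁₀ ys v′ v E₁ E₂ ⊆w ⊆y ∌y ∌x (suc i) (suc j) i< _ _ | no _ =
    x∈p∧y∈p∧x≢y⇒2≤∣p∣ (witness₁₀₁ (here refl) (here refl))
      (witness₀₁₁ v∈ (∈-drop-last L₀₁₀ (ys ∷ʳ v′) (suc i) i<))
      (∈∉⇒≢ (All.head (leaving⊆ E₁)) (All.lookup (entering∉ E₁) (∈-++⁺ʳ L₀₁₀ v∈)))
    where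
    open Witnesses (p ∷ ps) L₁₀₀ L₀₁₀ ((ys ∷ʳ v′) ∷ʳ v) L₁₁₀ [] E₁ E₂ ⊆w ⊆y ∌y ∌x (suc i) (suc j)
    v∈ = ∈-++⁺ʳ (ys ∷ʳ v′) (here refl)

  crossing-via-L₀₀₁ : ∀ L₁₀₁ L₁₀₀ L₀₁₀ L₁₁₀ z z′ zs →
                      Crossing x w y L₁₀₁ L₁₀₀ L₀₁₀ [] L₁₁₀ (z ∷ z′ ∷ zs)
  crossing-via-L₀₀₁ L₁₀₁ L₁₀₀ L₀₁₀ L₁₁₀ z z′ zs E₁ E₂ ⊆w ⊆y ∌y ∌x i (suc (suc j)) _ _ _ =
    x∈p∧y∈p∧x≢y⇒2≤∣p∣ (witness₀₀₁ (here refl) (here refl))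
      (witness₀₀₁ (there (here refl)) (there (here refl)))
      (All.head (AllPairs.head (entering-unique E₂)))
    where open Witnesses L₁₀₁ L₁₀₀ L₀₁₀ [] L₁₁₀ (z ∷ z′ ∷ zs) E₁ E₂ ⊆w ⊆y ∌y ∌x i (suc (suc j))
  crossing-via-L₀₀₁ L₁₀₁ L₁₀₀ L₀₁₀ L₁₁₀ z z′ zs E₁ E₂ ⊆w ⊆y ∌y ∌x i 1 i< _ _ with initLast L₀₁₀
  ... | us ∷ʳ′ u =
    x∈p∧y∈p∧x≢y⇒2≤∣p∣ (witness₀₁₀ u∈drop-i u∈drop-1) (witness₀₀₁ (here refl) (here refl))
      (∈∉⇒≢ (All.lookup ⊆w (∈-++⁺ˡ (∈-++⁺ʳ us (here refl)))) (All.head (entering∉ E₂)))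
    where
    open Witnesses L₁₀₁ L₁₀₀ (us ∷ʳ u) [] L₁₁₀ (z ∷ z′ ∷ zs) E₁ E₂ ⊆w ⊆y ∌y ∌x i 1
    u∈drop-i : u ∈ˡ drop i ((us ∷ʳ u) ++ [])
    u∈drop-i = ∈-drop-++ˡ (us ∷ʳ u) i
                 (∈-drop-last [] us i (subst (i <_) (cong length (++-identityʳ (us ∷ʳ u))) i<))
    u∈drop-1 : u ∈ˡ drop 1 (L₁₁₀ ++ (us ∷ʳ u))
    u∈drop-1 = ∈-drop-last L₁₁₀ us 1 (subst (1 <_) (sym (same-length E₂)) (s≤s (s≤s z≤n)))

crossing : ∀ {x w y : Subset n} L₁₀₁ L₁₀₀ L₀₁₀ L₀₁₁ L₁₁₀ L₀₀₁ →
           2 ≤ length L₀₁₁ + length L₀₀₁ → Crossing x w y L₁₀₁ L₁₀₀ L₀₁₀ L₀₁₁ L₁₁₀ L₀₀₁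
crossing L₁₀₁ L₁₀₀ L₀₁₀ L₀₁₁ L₁₁₀ (z ∷ z′ ∷ zs) _ with initLast L₀₁₁
... | ys ∷ʳ′ v = crossing-via-L₀₁₁-L₀₀₁ L₁₀₁ L₁₀₀ L₀₁₀ L₁₁₀ ys v z (z′ ∷ zs)
... | []      = crossing-via-L₀₀₁ L₁₀₁ L₁₀₀ L₀₁₀ L₁₁₀ z z′ zs
crossing L₁₀₁ L₁₀₀ L₀₁₀ L₀₁₁ L₁₁₀ (z ∷ []) _ with initLast L₀₁₁
... | ys ∷ʳ′ v = crossing-via-L₀₁₁-L₀₀₁ L₁₀₁ L₁₀₀ L₀₁₀ L₁₁₀ ys v z []
crossing _ _ _ _ _ (_ ∷ []) (s≤s ()) | []
crossing L₁₀₁ L₁₀₀ L₀₁₀ L₀₁₁ L₁₁₀ [] _ with initLast L₀₁₁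
... | ys ∷ʳ′ v with initLast ys
...   | ys′ ∷ʳ′ v′ = crossing-via-L₀₁₁ L₁₀₁ L₁₀₀ L₀₁₀ L₁₁₀ ys′ v′ v
crossing _ _ _ _ _ [] (s≤s ()) | _ ∷ʳ′ _ | []
crossing _ _ _ _ _ [] () | []

module Detour {r : ℕ} {x w y : Subset n} (∣x∣≡r : ∣ x ∣ ≡ r) (∣w∣≡r : ∣ w ∣ ≡ r) (∣y∣≡r : ∣ y ∣ ≡ r)
              (2≤∣x─y∣ : 2 ≤ ∣ x ─ y ∣) where

  L₁₀₁ L₁₀₀ L₀₁₀ L₀₁₁ L₁₁₀ L₀₀₁ : List (Fin n)
  L₁₀₁ = elements ((x ─ w) ∩ y)
  L₁₀₀ = elements (x ─ w ─ y)
  L₀₁₀ = elements (w ─ x ─ y)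
  L₀₁₁ = elements ((w ─ x) ∩ y)
  L₁₁₀ = elements ((w ─ y) ∩ x)
  L₀₀₁ = elements (y ─ w ─ x)

  ∈L₁₀₁ : z ∈ˡ L₁₀₁ → z ∈ x × z ∉ w × z ∈ y
  ∈L₁₀₁ = ∈-[p─q]∩s⁻ ∘ ∈-elements⁻
  ∈L₁₀₀ : z ∈ˡ L₁₀₀ → z ∈ x × z ∉ w × z ∉ y
  ∈L₁₀₀ = ∈-p─q─s⁻ ∘ ∈-elements⁻
  ∈L₀₁₀ : z ∈ˡ L₀₁₀ → z ∉ x × z ∈ w × z ∉ y
  ∈L₀₁₀ z∈ = let z∈w , z∉x , z∉y = ∈-p─q─s⁻ (∈-elements⁻ z∈) in z∉x , z∈w , z∉y
  ∈L₀₁₁ : z ∈ˡ L₀₁₁ → z ∉ x × z ∈ w × z ∈ y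
  ∈L₀₁₁ z∈ = let z∈w , z∉x , z∈y = ∈-[p─q]∩s⁻ (∈-elements⁻ z∈) in z∉x , z∈w , z∈y
  ∈L₁₁₀ : z ∈ˡ L₁₁₀ → z ∈ x × z ∈ w × z ∉ y
  ∈L₁₁₀ z∈ = let z∈w , z∉y , z∈x = ∈-[p─q]∩s⁻ (∈-elements⁻ z∈) in z∈x , z∈w , z∉y
  ∈L₀₀₁ : z ∈ˡ L₀₀₁ → z ∉ x × z ∉ w × z ∈ y
  ∈L₀₀₁ z∈ = let z∈y , z∉w , z∉x = ∈-p─q─s⁻ (∈-elements⁻ z∈) in z∉x , z∉w , z∈y

  private
    at-x : ∀ {A B C : Set} → A × B × C → A
    at-x = proj₁
    at-w : ∀ {A B C : Set} → A × B × C → B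
    at-w = proj₁ ∘ proj₂
    at-y : ∀ {A B C : Set} → A × B × C → C
    at-y = proj₂ ∘ proj₂

  E₁ : Exchangeable x (L₁₀₁ ++ L₁₀₀) (L₀₁₀ ++ L₀₁₁)
  E₁ = record
    { same-length = begin
        length (L₁₀₁ ++ L₁₀₀)           ≡⟨ length-elements-++ ((x ─ w) ∩ y) (x ─ w ─ y) ⟩
        ∣ (x ─ w) ∩ y ∣ + ∣ x ─ w ─ y ∣ ≡⟨ ∣p∣≡∣p∩q∣+∣p─q∣ (x ─ w) y ⟨
        ∣ x ─ w ∣                        ≡⟨ ∣p∣≡∣q∣⇒∣p─q∣≡∣q─p∣ x w (trans ∣x∣≡r (sym ∣w∣≡r)) ⟩
        ∣ w ─ x ∣                        ≡⟨ ∣p∣≡∣p∩q∣+∣p─q∣ (w ─ x) y ⟩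
        ∣ (w ─ x) ∩ y ∣ + ∣ w ─ x ─ y ∣ ≡⟨ ℕ.+-comm ∣ (w ─ x) ∩ y ∣ ∣ w ─ x ─ y ∣ ⟩
        ∣ w ─ x ─ y ∣ + ∣ (w ─ x) ∩ y ∣ ≡⟨ length-elements-++ (w ─ x ─ y) ((w ─ x) ∩ y) ⟨
        length (L₀₁₀ ++ L₀₁₁)           ∎
    ; leaving-unique  = unique-elements-++ ((x ─ w) ∩ y) (x ─ w ─ y)
                          λ z∈ z∈′ → at-y (∈L₁₀₀ z∈′) (at-y (∈L₁₀₁ z∈))
    ; entering-unique = unique-elements-++ (w ─ x ─ y) ((w ─ x) ∩ y)
                          λ z∈ z∈′ → at-y (∈L₀₁₀ z∈) (at-y (∈L₀₁₁ z∈′))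
    ; leaving⊆  = All.++⁺ (All.tabulate (at-x ∘ ∈L₁₀₁)) (All.tabulate (at-x ∘ ∈L₁₀₀))
    ; entering∉ = All.++⁺ (All.tabulate (at-x ∘ ∈L₀₁₀)) (All.tabulate (at-x ∘ ∈L₀₁₁))
    }
    where open ≡-Reasoning

  E₂ : Exchangeable w (L₁₁₀ ++ L₀₁₀) (L₀₀₁ ++ L₁₀₁)
  E₂ = record
    { same-length = begin
        length (L₁₁₀ ++ L₀₁₀)           ≡⟨ length-elements-++ ((w ─ y) ∩ x) (w ─ x ─ y) ⟩
        ∣ (w ─ y) ∩ x ∣ + ∣ w ─ x ─ y ∣ ≡⟨ cong (λ s → ∣ (w ─ y) ∩ x ∣ + ∣ s ∣) (p─q─r≡p─r─q w x y) ⟩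
        ∣ (w ─ y) ∩ x ∣ + ∣ w ─ y ─ x ∣ ≡⟨ ∣p∣≡∣p∩q∣+∣p─q∣ (w ─ y) x ⟨
        ∣ w ─ y ∣                        ≡⟨ ∣p∣≡∣q∣⇒∣p─q∣≡∣q─p∣ w y (trans ∣w∣≡r (sym ∣y∣≡r)) ⟩
        ∣ y ─ w ∣                        ≡⟨ ∣p∣≡∣p∩q∣+∣p─q∣ (y ─ w) x ⟩
        ∣ (y ─ w) ∩ x ∣ + ∣ y ─ w ─ x ∣ ≡⟨ ℕ.+-comm ∣ (y ─ w) ∩ x ∣ ∣ y ─ w ─ x ∣ ⟩
        ∣ y ─ w ─ x ∣ + ∣ (y ─ w) ∩ x ∣ ≡⟨ cong (λ s → ∣ y ─ w ─ x ∣ + ∣ s ∣) (p─q∩r≡r─q∩p y w x) ⟩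
        ∣ y ─ w ─ x ∣ + ∣ (x ─ w) ∩ y ∣ ≡⟨ length-elements-++ (y ─ w ─ x) ((x ─ w) ∩ y) ⟨
        length (L₀₀₁ ++ L₁₀₁)           ∎
    ; leaving-unique  = unique-elements-++ ((w ─ y) ∩ x) (w ─ x ─ y)
                          λ z∈ z∈′ → at-x (∈L₀₁₀ z∈′) (at-x (∈L₁₁₀ z∈))
    ; entering-unique = unique-elements-++ (y ─ w ─ x) ((x ─ w) ∩ y)
                          λ z∈ z∈′ → at-x (∈L₀₀₁ z∈) (at-x (∈L₁₀₁ z∈′))
    ; leaving⊆  = All.++⁺ (All.tabulate (at-w ∘ ∈L₁₁₀)) (All.tabulate (at-w ∘ ∈L₀₁₀))
    ; entering∉ = All.++⁺ (All.tabulate (at-w ∘ ∈L₀₀₁)) (All.tabulate (at-w ∘ ∈L₁₀₁))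
    }
    where open ≡-Reasoning

  F₁ F₂ : ℕ → Subset n
  F₁ = exchanges x (L₁₀₁ ++ L₁₀₀) (L₀₁₀ ++ L₀₁₁)
  F₂ = exchanges w (L₁₁₀ ++ L₀₁₀) (L₀₀₁ ++ L₁₀₁)

  k m : ℕ
  k = length (L₁₀₁ ++ L₁₀₀)
  m = length (L₁₁₀ ++ L₀₁₀)

  F₁-end : F₁ k ≡ w
  F₁-end = exchanges-end E₁
    (All.++⁺ (All.tabulate (at-w ∘ ∈L₁₀₁)) (All.tabulate (at-w ∘ ∈L₁₀₀)))
    (All.++⁺ (All.tabulate (at-w ∘ ∈L₀₁₀)) (All.tabulate (at-w ∘ ∈L₀₁₁)))
    (λ {z} z∈x z∉w → [ (λ z∈y → ∈-++⁺ˡ (∈-elements⁺ (∈-[p─q]∩s⁺ z∈x z∉w z∈y)))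
                     , (λ z∉y → ∈-++⁺ʳ L₁₀₁ (∈-elements⁺ (∈-p─q─s⁺ z∈x z∉w z∉y)))
                     ]′ (toSum (z ∈? y)))
    (λ {z} z∈w z∉x → [ (λ z∈y → ∈-++⁺ʳ L₀₁₀ (∈-elements⁺ (∈-[p─q]∩s⁺ z∈w z∉x z∈y)))
                     , (λ z∉y → ∈-++⁺ˡ (∈-elements⁺ (∈-p─q─s⁺ z∈w z∉x z∉y)))
                     ]′ (toSum (z ∈? y)))

  F₂-end : F₂ m ≡ y
  F₂-end = exchanges-end E₂
    (All.++⁺ (All.tabulate (at-y ∘ ∈L₁₁₀)) (All.tabulate (at-y ∘ ∈L₀₁₀)))
    (All.++⁺ (All.tabulate (at-y ∘ ∈L₀₀₁)) (All.tabulate (at-y ∘ ∈L₁₀₁)))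
    (λ {z} z∈w z∉y → [ (λ z∈x → ∈-++⁺ˡ (∈-elements⁺ (∈-[p─q]∩s⁺ z∈w z∉y z∈x)))
                     , (λ z∉x → ∈-++⁺ʳ L₁₁₀ (∈-elements⁺ (∈-p─q─s⁺ z∈w z∉x z∉y)))
                     ]′ (toSum (z ∈? x)))
    (λ {z} z∈y z∉w → [ (λ z∈x → ∈-++⁺ʳ L₀₀₁ (∈-elements⁺ (∈-[p─q]∩s⁺ z∈x z∉w z∈y)))
                     , (λ z∉x → ∈-++⁺ˡ (∈-elements⁺ (∈-p─q─s⁺ z∈y z∉w z∉x)))
                     ]′ (toSum (z ∈? x)))

  private
    2≤∣L₀₁₁∣+∣L₀₀₁∣ : 2 ≤ length L₀₁₁ + length L₀₀₁
    2≤∣L₀₁₁∣+∣L₀₀₁∣ = subst (2 ≤_) (sym (begin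
      length L₀₁₁ + length L₀₀₁        ≡⟨ cong₂ _+_ (length-elements ((w ─ x) ∩ y))
                                                    (length-elements (y ─ w ─ x)) ⟩
      ∣ (w ─ x) ∩ y ∣ + ∣ y ─ w ─ x ∣ ≡⟨ cong₂ (λ a b → ∣ a ∣ + ∣ b ∣)
                                                (p─q∩r≡r─q∩p w x y) (p─q─r≡p─r─q y w x) ⟩
      ∣ (y ─ x) ∩ w ∣ + ∣ y ─ x ─ w ∣ ≡⟨ ∣p∣≡∣p∩q∣+∣p─q∣ (y ─ x) w ⟨
      ∣ y ─ x ∣                        ≡⟨ ∣p∣≡∣q∣⇒∣p─q∣≡∣q─p∣ y x (trans ∣y∣≡r (sym ∣x∣≡r)) ⟩
      ∣ x ─ y ∣                        ∎)) 2≤∣x─y∣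
      where open ≡-Reasoning

  F : ℕ → Subset n
  F = glue k F₁ F₂

  F-path : ExchangePath r F (k + m)
  F-path = glue-path
    (subst (λ r → ExchangePath r F₁ k) ∣x∣≡r (exchanges-path E₁))
    (subst (λ r → ExchangePath r F₂ m) ∣w∣≡r (exchanges-path E₂))
    F₁-end
    (λ s t s<k 0<t t≤m → crossing L₁₀₁ L₁₀₀ L₀₁₀ L₀₁₁ L₁₁₀ L₀₀₁ 2≤∣L₀₁₁∣+∣L₀₀₁∣ E₁ E₂
       (All.++⁺ (All.tabulate (at-w ∘ ∈L₀₁₀)) (All.tabulate (at-w ∘ ∈L₀₁₁)))
       (All.tabulate (at-y ∘ ∈L₀₁₁))
       (All.++⁺ (All.tabulate (at-y ∘ ∈L₁₁₀)) (All.tabulate (at-y ∘ ∈L₀₁₀)))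
       (All.tabulate (at-x ∘ ∈L₀₀₁))
       s t (subst (s <_) (same-length E₁) s<k) 0<t (subst (t ≤_) (same-length E₂) t≤m))

  F-start : F 0 ≡ x
  F-start = glue-≤ {k = k} {f = F₁} {g = F₂} F₁-end z≤n

  F-via : F k ≡ w
  F-via = trans (glue-≤ {k = k} {f = F₁} {g = F₂} F₁-end ℕ.≤-refl) F₁-end

  F-end : F (k + m) ≡ y
  F-end = trans (glue-+ k m) F₂-end

-- The Johnson graph

r≢r∸1 : ∀ {r} → 1 ≤ r → r ≢ r ∸ 1
r≢r∸1 {suc r} _ eq = ℕ.1+n≰n (ℕ.≤-reflexive eq)

r≢r∸1+d : ∀ r {d} → 2 ≤ d → r ≢ r ∸ 1 + d
r≢r∸1+d zero    (s≤s (s≤s _)) ()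
r≢r∸1+d (suc r) 2≤d eq = ℕ.1+n≰n (begin
  2 + r     ≡⟨ ℕ.+-comm 2 r ⟩
  r + 2     ≤⟨ ℕ.+-monoʳ-≤ r 2≤d ⟩
  r + _     ≡⟨ eq ⟨
  suc r     ∎)
  where open ℕ.≤-Reasoning

apart⇒≢ : ∀ (p q : Subset n) → 2 ≤ ∣ q ─ p ∣ → p ≢ q
apart⇒≢ p q apart refl = contradiction (subst (2 ≤_) (∣p─p∣≡0 p) apart) λ ()

apart⇒¬adjacent : ∀ {r} (p q : Subset n) → ∣ q ∣ ≡ r → 2 ≤ ∣ q ─ p ∣ → ∣ p ∩ q ∣ ≢ r ∸ 1
apart⇒¬adjacent {r = r} p q ∣q∣≡r apart ∣p∩q∣≡r∸1 = r≢r∸1+d r apart (begin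
  r                     ≡⟨ ∣q∣≡r ⟨
  ∣ q ∣                 ≡⟨ ∣p∣≡∣p∩q∣+∣p─q∣ q p ⟩
  ∣ q ∩ p ∣ + ∣ q ─ p ∣ ≡⟨ cong (λ s → ∣ s ∣ + ∣ q ─ p ∣) (∩-comm q p) ⟩
  ∣ p ∩ q ∣ + ∣ q ─ p ∣ ≡⟨ cong (_+ ∣ q ─ p ∣) ∣p∩q∣≡r∸1 ⟩
  r ∸ 1 + ∣ q ─ p ∣     ∎)
  where open ≡-Reasoning

distinct∧¬adjacent⇒apart : ∀ {r} (p q : Subset n) → ∣ p ∣ ≡ r → ∣ q ∣ ≡ r →
                           p ≢ q → ∣ p ∩ q ∣ ≢ r ∸ 1 → 2 ≤ ∣ p ─ q ∣
distinct∧¬adjacent⇒apart {r = r} p q ∣p∣≡r ∣q∣≡r p≢q ¬adj with ∣ p ─ q ∣ in ∣p─q∣≡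
... | zero        = contradiction (⊆-antisym (∣p─q∣≡0⇒p⊆q ∣p─q∣≡) (∣p─q∣≡0⇒p⊆q ∣q─p∣≡0)) p≢q
  where ∣q─p∣≡0 = trans (sym (∣p∣≡∣q∣⇒∣p─q∣≡∣q─p∣ p q (trans ∣p∣≡r (sym ∣q∣≡r)))) ∣p─q∣≡
... | suc zero    = contradiction (begin
      ∣ p ∩ q ∣                 ≡⟨ ℕ.m+n∸n≡m ∣ p ∩ q ∣ 1 ⟨
      ∣ p ∩ q ∣ + 1 ∸ 1         ≡⟨ cong (λ d → ∣ p ∩ q ∣ + d ∸ 1) ∣p─q∣≡ ⟨
      ∣ p ∩ q ∣ + ∣ p ─ q ∣ ∸ 1 ≡⟨ cong (_∸ 1) (trans (sym (∣p∣≡∣p∩q∣+∣p─q∣ p q)) ∣p∣≡r) ⟩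
      r ∸ 1                     ∎) ¬adj
  where open ≡-Reasoning
... | suc (suc _) = s≤s (s≤s z≤n)

module _ {n r : ℕ} where

  vertex-≡ : {u v : JVertex n r} → proj₁ u ≡ proj₁ v → u ≡ v
  vertex-≡ {u = A , p} {v = .A , q} refl = cong (A ,_) (ℕ.≡-irrelevant p q)

  adjacent-sym : ∀ {u v : JVertex n r} → Adj (Johnson n r) u v → Adj (Johnson n r) v u
  adjacent-sym {u = A , _} {v = B , _} = trans (cong ∣_∣ (∩-comm B A))

  adjacent-irrefl : 1 ≤ r → ∀ {u : JVertex n r} → ¬ Adj (Johnson n r) u u
  adjacent-irrefl 1≤r {A , ∣A∣≡r} ∣A∩A∣≡r∸1 =
    r≢r∸1 1≤r (trans (sym ∣A∣≡r) (trans (cong ∣_∣ (sym (∩-idem A))) ∣A∩A∣≡r∸1))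

  apart⇒on-induced-path : ∀ (u v w : JVertex n r) → 2 ≤ ∣ proj₁ u ─ proj₁ v ∣ →
                          OnInducedPath (Johnson n r) u v w
  apart⇒on-induced-path (x , ∣x∣≡r) (y , ∣y∣≡r) (w , ∣w∣≡r) 2≤∣x─y∣ =
    on-induced-path (Johnson n r) (λ {u} {v} → adjacent-sym {u} {v}) (λ {u} → adjacent-irrefl 1≤r {u})
      f (k + m) (adjacent F-path) distant
      (vertex-≡ F-start) (vertex-≡ F-end) k (ℕ.m≤m+n k m) (vertex-≡ F-via)
    where
    open Detour {x = x} {w} {y} ∣x∣≡r ∣w∣≡r ∣y∣≡r 2≤∣x─y∣
    open ExchangePath
    f : ℕ → JVertex n r
    f t = F t , size F-path t
    1≤r : 1 ≤ r
    1≤r = ℕ.≤-trans (s≤s z≤n) (ℕ.≤-trans 2≤∣x─y∣ (ℕ.≤-trans (∣p─q∣≤∣p∣ x y) (ℕ.≤-reflexive ∣x∣≡r)))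
    distant : ∀ s t → 2 + s ≤ t → t ≤ k + m → f s ≢ f t × ¬ Adj (Johnson n r) (f s) (f t)
    distant s t 2+s≤t t≤ =
      apart⇒≢ (F s) (F t) (apart F-path s t 2+s≤t t≤) ∘ cong proj₁ ,
      apart⇒¬adjacent (F s) (F t) (size F-path t) (apart F-path s t 2+s≤t t≤)

  apart⇒monophonic : ∀ (u v : JVertex n r) → 2 ≤ ∣ proj₁ u ─ proj₁ v ∣ →
                     Monophonic (Johnson n r) (u ∷ v ∷ [])
  apart⇒monophonic u v apart w =
    u , v , here refl , there (here refl) , inj₂ (inj₂ (apart⇒on-induced-path u v w apart))

apart-vertices : ∀ {n} r → 2 ≤ r → 2 + r ≤ n →
                 Σ[ u ∈ JVertex n r ] Σ[ v ∈ JVertex n r ] 2 ≤ ∣ proj₁ u ─ proj₁ v ∣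
apart-vertices (suc zero) (s≤s ()) _
apart-vertices {suc (suc zero)}       2 _ (s≤s (s≤s ()))
apart-vertices {suc (suc (suc zero))} 2 _ (s≤s (s≤s (s≤s ())))
apart-vertices {suc (suc (suc (suc n)))} 2 _ _ =
  (inside ∷ inside ∷ outside ∷ outside ∷ ⊥ , cong (2 +_) (∣⊥∣≡0 n)) ,
  (outside ∷ outside ∷ inside ∷ inside ∷ ⊥ , cong (2 +_) (∣⊥∣≡0 n)) ,
  s≤s (s≤s z≤n)
apart-vertices {suc n} (suc (suc (suc r))) _ (s≤s 2+r≤n)
  with apart-vertices (suc (suc r)) (s≤s (s≤s z≤n)) 2+r≤n
... | (A , ∣A∣≡r) , (B , ∣B∣≡r) , apart =
  (inside ∷ A , cong suc ∣A∣≡r) , (inside ∷ B , cong suc ∣B∣≡r) , apart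

2+r≤n : ∀ {n r} → 2 ≤ r → r ≤ n ∸ 2 → 2 + r ≤ n
2+r≤n {suc (suc n)} _             r≤n∸2 = s≤s (s≤s r≤n∸2)
2+r≤n {suc zero}    (s≤s (s≤s _)) ()
2+r≤n {zero}        (s≤s (s≤s _)) ()

theorem3p13 : (n r : ℕ) → 2 ≤ r → r ≤ n ∸ 2 → StronglyTwoMonophonic (Johnson n r)
theorem3p13 n r 2≤r r≤n∸2 =
  ( (u₀ ∷ v₀ ∷ [] , (u₀≢v₀ ∷ []) ∷ [] ∷ [] , refl , apart⇒monophonic u₀ v₀ apart₀)
  , λ S _ → monophonic⇒2≤length (Johnson n r) u₀≢v₀ S )
  , λ u v u≢v ¬adj → apart⇒monophonic u v
      (distinct∧¬adjacent⇒apart (proj₁ u) (proj₁ v) (proj₂ u) (proj₂ v) (u≢v ∘ vertex-≡) ¬adj)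
  where
  pair = apart-vertices r 2≤r (2+r≤n 2≤r r≤n∸2)
  u₀ v₀ : JVertex n r
  u₀ = proj₁ pair
  v₀ = proj₁ (proj₂ pair)
  apart₀ : 2 ≤ ∣ proj₁ u₀ ─ proj₁ v₀ ∣
  apart₀ = proj₂ (proj₂ pair)
  u₀≢v₀ : u₀ ≢ v₀
  u₀≢v₀ = apart⇒≢ (proj₁ v₀) (proj₁ u₀) apart₀ ∘ sym ∘ cong proj₁
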